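{- Let $d,\ell\ge 2$. The girth $g$ of the cyclic Kautz digraph $CK(d,\ell)$ satisfies $g\ge k_0$, where $k_0$ is the minimum positive integer $k$ such that $\ell\not\equiv 1 \pmod{k}$.
   Context: $CK(d,\ell)$ is the digraph whose vertices are the words $x_1x_2\ldots x_\ell$ over $\mathbb{Z}_{d+1}$ with $x_i\neq x_{i+1}$ for $i=1,\dots,\ell-1$ and $x_\ell\neq x_1$, with arcs $x_1x_2\ldots x_\ell\to x_2\ldots x_\ell y$ for every $y\in\mathbb{Z}_{d+1}$ with $y\neq x_2,x_\ell$. The girth is the length of a shortest directed cycle. -}

module Defs where

open import Data.Nat using (ℕ; zero; suc; _∸_; _≤_; _<_)
open import Data.Nat.Divisibility using (_∣_)
open import Data.Fin using (Fin; toℕ; inject₁; fromℕ)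
open import Data.Vec using (Vec; lookup)
open import Data.Product using (Σ; _×_; _,_)
open import Relation.Binary.PropositionalEquality using (_≡_; _≢_)
open import Relation.Nullary using (¬_)

-- Alphabet Z_{d+1}, represented as Fin (suc d).
-- Words of length ℓ; positions are 0-based: position p here = x_{p+1} in the paper.
Word : ℕ → ℕ → Set
Word d ℓ = Vec (Fin (suc d)) ℓ

ValidWord : {d ℓ : ℕ} → Word d ℓ → Set
ValidWord {d} {ℓ} x =
  ((i j : Fin ℓ) → toℕ j ≡ suc (toℕ i) → lookup x i ≢ lookup x j) ×
  ((i j : Fin ℓ) → toℕ i ≡ 0 → toℕ j ≡ ℓ ∸ 1 → lookup x i ≢ lookup x j)

Vertex : ℕ → ℕ → Set
Vertex d ℓ = Σ (Word d ℓ) ValidWord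

-- Arc x_1…x_ℓ → x_2…x_ℓ y with y ≠ x_2 and y ≠ x_ℓ.
Arc : {d ℓ : ℕ} → Vertex d ℓ → Vertex d ℓ → Set
Arc {d} {ℓ} (x , _) (w , _) = Σ (Fin (suc d)) λ y →
  ((j : Fin ℓ) → toℕ j ≡ 1 → y ≢ lookup x j) ×
  ((j : Fin ℓ) → toℕ j ≡ ℓ ∸ 1 → y ≢ lookup x j) ×
  ((i j : Fin ℓ) → toℕ j ≡ suc (toℕ i) → lookup w i ≡ lookup x j) ×
  ((i : Fin ℓ) → toℕ i ≡ ℓ ∸ 1 → lookup w i ≡ y)

record Cycle (d ℓ n : ℕ) : Set where
  field
    vtx      : Fin (suc n) → Vertex d ℓ
    distinct : (i j : Fin (suc n)) → vtx i ≡ vtx j → i ≡ j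
    step     : (i : Fin n) → Arc (vtx (inject₁ i)) (vtx (Data.Fin.suc i))
    close    : Arc (vtx (fromℕ n)) (vtx Data.Fin.zero)

GirthAtLeast : ℕ → ℕ → ℕ → Set
GirthAtLeast d ℓ g = (n : ℕ) → Cycle d ℓ n → g ≤ suc n

-- k0 is the minimum positive k with ℓ ≢ 1 (mod k), i.e. ¬ (k ∣ ℓ - 1)  (ℓ ≥ 1).
IsK0 : ℕ → ℕ → Set
IsK0 ℓ k0 = (1 ≤ k0) × (¬ (k0 ∣ ℓ ∸ 1)) × ((k : ℕ) → 1 ≤ k → k < k0 → k ∣ ℓ ∸ 1)

-- Following a closed walk of length N in CK(d,ℓ) shifts the word of its first vertex
-- N places to the left and returns it unchanged, so that word has period N. If N < k0
-- then N divides ℓ - 1, and the period then forces x_1 = x_ℓ, which no vertex allows.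
module Submission where

open import Defs
open import Data.Nat using (ℕ; zero; suc; _+_; _*_; _<_; _≤_; _≤?_; s≤s; z≤n)
open import Data.Nat.Properties using (+-identityʳ; +-assoc; +-comm; m≤m+n; ≤-trans; ≤-reflexive; ≤-<-trans; suc-injective; ≰⇒>)
open import Data.Nat.Divisibility using (_∣_; divides)
open import Data.Fin as Fin using (Fin; toℕ; fromℕ; fromℕ<; inject₁)
open import Data.Fin.Properties using (toℕ-fromℕ<; toℕ-injective; toℕ<n; toℕ-inject₁; toℕ-fromℕ)
open import Data.Vec using (Vec; lookup)
open import Data.Product using (Σ; _,_; _×_; proj₁; proj₂)
open import Data.Empty using (⊥-elim)
open import Relation.Binary.PropositionalEquality using (_≡_; refl; sym; trans; cong)
open import Relation.Nullary using (¬_; yes; no)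

HasPeriod : {A : Set} {ℓ : ℕ} → Vec A ℓ → ℕ → Set
HasPeriod {ℓ = ℓ} x p = (a b : Fin ℓ) → toℕ b ≡ toℕ a + p → lookup x a ≡ lookup x b

hasPeriod-zero : {A : Set} {ℓ : ℕ} (x : Vec A ℓ) → HasPeriod x 0
hasPeriod-zero x a b b≡a+0 = cong (lookup x) (toℕ-injective (sym (trans b≡a+0 (+-identityʳ (toℕ a)))))

index-between : {ℓ : ℕ} (a b : Fin ℓ) (k m : ℕ) → toℕ b ≡ toℕ a + (k + m) →
                Σ (Fin ℓ) λ c → toℕ c ≡ toℕ a + k
index-between {ℓ} a b k m b≡a+k+m = fromℕ< a+k<ℓ , toℕ-fromℕ< a+k<ℓ
  where
  a+k<ℓ : toℕ a + k < ℓ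
  a+k<ℓ = ≤-<-trans (≤-trans (m≤m+n (toℕ a + k) m)
                             (≤-reflexive (trans (+-assoc (toℕ a) k m) (sym b≡a+k+m))))
                    (toℕ<n b)

reassociate : (a k m : ℕ) {b c : ℕ} → b ≡ a + (k + m) → c ≡ a + k → b ≡ c + m
reassociate a k m b≡a+k+m c≡a+k =
  trans b≡a+k+m (trans (sym (+-assoc a k m)) (cong (_+ m) (sym c≡a+k)))

hasPeriod-* : {A : Set} {ℓ : ℕ} (x : Vec A ℓ) {p : ℕ} → HasPeriod x p → ∀ t → HasPeriod x (t * p)
hasPeriod-* x per zero = hasPeriod-zero x
hasPeriod-* x {p} per (suc t) a b b≡a+p+tp with index-between a b p (t * p) b≡a+p+tp
... | c , c≡a+p =
  trans (per a c c≡a+p) (hasPeriod-* x per t c b (reassociate (toℕ a) p (t * p) b≡a+p+tp c≡a+p))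

validWord-¬period : {d m : ℕ} (x : Word d (suc m)) → ValidWord x → {p : ℕ} → p ∣ m → ¬ HasPeriod x p
validWord-¬period {m = m} x (_ , first≢last) (divides t m≡tp) per =
  first≢last Fin.zero (fromℕ m) refl (toℕ-fromℕ m)
    (hasPeriod-* x per t Fin.zero (fromℕ m) (trans (toℕ-fromℕ m) m≡tp))

arc-lookup : {d ℓ : ℕ} (u v : Vertex d ℓ) → Arc u v →
             (a c : Fin ℓ) → toℕ c ≡ suc (toℕ a) → lookup (proj₁ v) a ≡ lookup (proj₁ u) c
arc-lookup _ _ (_ , _ , _ , shifted , _) = shifted

arc-lookup-step : {d ℓ : ℕ} (u v : Vertex d ℓ) → Arc u v →
                  (j : ℕ) (a b : Fin ℓ) → toℕ b ≡ toℕ a + suc j →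
                  Σ (Fin ℓ) λ c → lookup (proj₁ v) a ≡ lookup (proj₁ u) c × toℕ b ≡ toℕ c + j
arc-lookup-step u v arc j a b b≡a+1+j with index-between a b 1 j b≡a+1+j
... | c , c≡a+1 = c , arc-lookup u v arc a c (trans c≡a+1 (+-comm (toℕ a) 1))
                    , reassociate (toℕ a) 1 j b≡a+1+j c≡a+1

module _ {d ℓ n : ℕ} (C : Cycle d ℓ n) where
  open Cycle C

  word : Fin (suc n) → Word d ℓ
  word i = proj₁ (vtx i)

  word-shift : ∀ j (i : Fin (suc n)) → toℕ i ≡ j →
               (a b : Fin ℓ) → toℕ b ≡ toℕ a + j → lookup (word i) a ≡ lookup (word Fin.zero) b
  word-shift zero    Fin.zero    _    = hasPeriod-zero (word Fin.zero)
  word-shift (suc j) (Fin.suc i) i≡j a b b≡a+1+j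
    with arc-lookup-step (vtx (inject₁ i)) (vtx (Fin.suc i)) (step i) j a b b≡a+1+j
  ... | c , v≡u , b≡c+j =
    trans v≡u (word-shift j (inject₁ i) (trans (toℕ-inject₁ i) (suc-injective i≡j)) c b b≡c+j)

  word-period : HasPeriod (word Fin.zero) (suc n)
  word-period a b b≡a+1+n
    with arc-lookup-step (vtx (fromℕ n)) (vtx Fin.zero) close n a b b≡a+1+n
  ... | c , v≡u , b≡c+n = trans v≡u (word-shift n (fromℕ n) (toℕ-fromℕ n) c b b≡c+n)

mainTheorem8 : (d ℓ : ℕ) → 2 ≤ d → 2 ≤ ℓ → (k0 : ℕ) → IsK0 ℓ k0 → GirthAtLeast d ℓ k0
mainTheorem8 d (suc m) _ _ k0 (_ , _ , below) n C with k0 ≤? suc n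
... | yes k0≤N = k0≤N
... | no  k0≰N = ⊥-elim (validWord-¬period (word C Fin.zero) (proj₂ (Cycle.vtx C Fin.zero))
                          (below (suc n) (s≤s z≤n) (≰⇒> k0≰N)) (word-period C))
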